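{- Let $U_1,U_2,V_1,V_2$ be $\lambda H$-terms such that $E(U_1)=E(U_2)$ and $E(V_1)=E(V_2)$, and let $x$ be a variable. Then $E(U_1[V_1/x])=E(U_2[V_2/x])$.
   Context: $\lambda H$-terms are the $\lambda$-terms built from variables and one additional constant $H$ by abstraction and application; $U[V/x]$ denotes (capture-avoiding) substitution. Application is left-associative: $T\,U_1\ldots U_n$ means $(\ldots(T\,U_1)\ldots U_n)$. The map $E$ on $\lambda H$-terms is defined by induction: $E(x)=x$ for variables $x$; $E(H)=H$; $E(\lambda x\,U)=\lambda x\,E(U)$; $E(U\,V)=E(U)\,E(V)$ if $U$ is not of the form $H\,U_1\ldots U_n$ with $n\ge 0$; and $E(H\,U_1U_2\ldots U_n)=E(U_1U_2\ldots U_n)$ for $n\ge1$. -}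

module Defs where

open import Data.Nat using (ℕ; zero; suc; _+_)
open import Data.Fin using (Fin; zero; suc; _≟_)
open import Data.List using (List; []; _∷_; _++_; [_])
open import Data.Product using (_×_; _,_)
open import Relation.Nullary using (yes; no)

-- λH-terms, well-scoped de Bruijn representation (terms up to α-equivalence).
-- Term n = λH-terms whose free variables are among n variables.
data Term (n : ℕ) : Set where
  var : Fin n → Term n
  H   : Term n
  lam : Term (suc n) → Term n
  app : Term n → Term n → Term n

ext : ∀ {m n} → (Fin m → Fin n) → Fin (suc m) → Fin (suc n)
ext ρ zero    = zero
ext ρ (suc i) = suc (ρ i)

rename : ∀ {m n} → (Fin m → Fin n) → Term m → Term n
rename ρ (var i)   = var (ρ i)
rename ρ H         = H
rename ρ (lam t)   = lam (rename (ext ρ) t)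
rename ρ (app t u) = app (rename ρ t) (rename ρ u)

exts : ∀ {m n} → (Fin m → Term n) → Fin (suc m) → Term (suc n)
exts σ zero    = var zero
exts σ (suc i) = rename suc (σ i)

subst : ∀ {m n} → (Fin m → Term n) → Term m → Term n
subst σ (var i)   = σ i
subst σ H         = H
subst σ (lam t)   = lam (subst (exts σ) t)
subst σ (app t u) = app (subst σ t) (subst σ u)

sub1 : ∀ {n} → Fin n → Term n → Fin n → Term n
sub1 x V y with x ≟ y
... | yes _ = V
... | no  _ = var y

_[_/_] : ∀ {n} → Term n → Term n → Fin n → Term n
U [ V / x ] = subst (sub1 x V) U

spine : ∀ {n} → Term n → Term n × List (Term n)
spine (app t u) with spine t
... | h , as = h , (as ++ [ u ])
spine t = t , []

apps : ∀ {n} → Term n → List (Term n) → Term n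
apps t []       = t
apps t (a ∷ as) = apps (app t a) as

size : ∀ {n} → Term n → ℕ
size (var _)   = 1
size H         = 1
size (lam t)   = suc (size t)
size (app t u) = suc (size t + size u)

-- The map E, following the paper's clauses literally; recursion is on a
-- fuel argument, and E supplies fuel = size, which is always sufficient
-- (every recursive call is on a term of strictly smaller size).
Efuel : ∀ {n} → ℕ → Term n → Term n
Efuel zero    t         = t   -- never reached from E
Efuel (suc k) (var x)   = var x
Efuel (suc k) H         = H
Efuel (suc k) (lam t)   = lam (Efuel k t)
Efuel (suc k) (app U V) with spine (app U V)
-- E(H U₁ U₂ … Uₙ) = E(U₁ U₂ … Uₙ), n ≥ 1
... | H , (A ∷ As) = Efuel k (apps A As)
-- E(U V) = E(U) E(V) when U is not of the form H U₁ … Uₙ (n ≥ 0)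
... | _ , _        = app (Efuel k U) (Efuel k V)

E : ∀ {n} → Term n → Term n
E t = Efuel (size t) t

module Submission where

-- E erases every head occurrence of H in an application spine, so it is the
-- structural image E′ of a term in which application is replaced by the
-- "smart" application H · b = b, a · b = a b otherwise.  E′ commutes with
-- renaming, and carries a substitution σ to the substitution by E′ ∘ σ in which
-- application is again the smart one.  Hence E (U[V/x]) is computed from E U
-- and E V alone.

open import Defs
open import Data.Nat using (ℕ; zero; suc; _+_; _≤_; _<_; s≤s)
open import Data.Nat.Properties using (≤-refl; ≤-trans; m≤m+n; m≤n+m; +-monoˡ-<; n≤1+n)
open import Data.Fin using (Fin; zero; suc; _≟_)
open import Data.List using (List; []; _∷_; _++_; [_])
open import Data.List.Properties using (++-conicalʳ)
open import Data.Product using (_,_; proj₁; proj₂)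
open import Data.Empty using (⊥-elim)
open import Relation.Nullary using (yes; no)
open import Relation.Binary.PropositionalEquality
  using (_≡_; _≢_; refl; sym; trans; cong; cong₂; module ≡-Reasoning)

infixl 7 _·_

_·_ : ∀ {n} → Term n → Term n → Term n
H · b = b
a · b = app a b

·-≢H : ∀ {n} {a : Term n} (b : Term n) → a ≢ H → a · b ≡ app a b
·-≢H {a = var _}   b _   = refl
·-≢H {a = H}       b a≢H = ⊥-elim (a≢H refl)
·-≢H {a = lam _}   b _   = refl
·-≢H {a = app _ _} b _   = refl

E′ : ∀ {n} → Term n → Term n
E′ (var i)   = var i
E′ H         = H
E′ (lam t)   = lam (E′ t)
E′ (app t u) = E′ t · E′ u

head : ∀ {n} → Term n → Term n
head t = proj₁ (spine t)

args : ∀ {n} → Term n → List (Term n)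
args t = proj₂ (spine t)

spine-app : ∀ {n} (U V : Term n) → spine (app U V) ≡ (head U , args U ++ [ V ])
spine-app U V with spine U
... | h , as = refl

apps-++-[] : ∀ {n} (t : Term n) as u → apps t (as ++ [ u ]) ≡ app (apps t as) u
apps-++-[] t []       u = refl
apps-++-[] t (a ∷ as) u = apps-++-[] (app t a) as u

apps-spine : ∀ {n} (t : Term n) → apps (head t) (args t) ≡ t
apps-spine (var i)   = refl
apps-spine H         = refl
apps-spine (lam t)   = refl
apps-spine (app t u) rewrite spine-app t u =
  trans (apps-++-[] (head t) (args t) u) (cong (λ s → app s u) (apps-spine t))

E′≡H⇒head≡H : ∀ {n} (t : Term n) → E′ t ≡ H → head t ≡ H
E′≡H⇒head≡H H         _ = refl
E′≡H⇒head≡H (app t u) e rewrite spine-app t u = go (E′ t) refl e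
  where
  go : ∀ a → E′ t ≡ a → a · E′ u ≡ H → head t ≡ H
  go H e′ _ = E′≡H⇒head≡H t e′

E′-apps-cong : ∀ {n} {a b : Term n} as → E′ a ≡ E′ b → E′ (apps a as) ≡ E′ (apps b as)
E′-apps-cong []       e = e
E′-apps-cong (u ∷ as) e = E′-apps-cong as (cong (_· E′ u) e)

size-apps-< : ∀ {n} {a b : Term n} as → size a < size b → size (apps a as) < size (apps b as)
size-apps-< []       lt = lt
size-apps-< (u ∷ as) lt = size-apps-< as (s≤s (+-monoˡ-< (size u) lt))

module _ {n} (k : ℕ) (IH : ∀ (t : Term n) → size t ≤ k → Efuel k t ≡ E′ t)
             (U V : Term n) (le : size U + size V ≤ k) where

  Efuel-app-H-spine : ∀ {A As} → spine (app U V) ≡ (H , A ∷ As) → Efuel k (apps A As) ≡ E′ (app U V)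
  Efuel-app-H-spine {A} {As} eq = begin
    Efuel k (apps A As)        ≡⟨ IH (apps A As) size-≤ ⟩
    E′ (apps A As)             ≡⟨ E′-apps-cong As refl ⟩
    E′ (apps (app H A) As)     ≡⟨ cong E′ unspine ⟩
    E′ (app U V)               ∎
    where
    open ≡-Reasoning
    unspine : apps (app H A) As ≡ app U V
    unspine = trans (cong (λ p → apps (proj₁ p) (proj₂ p)) (sym eq)) (apps-spine (app U V))
    size-≤ : size (apps A As) ≤ k
    size-≤ with size-apps-< {a = A} {b = app H A} As (s≤s (n≤1+n (size A)))
    ... | lt rewrite unspine with lt
    ... | s≤s lt′ = ≤-trans lt′ le

  Efuel-app-≢H : ∀ {h as} → spine (app U V) ≡ (h , as) → h ≢ H
               → app (Efuel k U) (Efuel k V) ≡ E′ (app U V)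
  Efuel-app-≢H eq h≢H = begin
    app (Efuel k U) (Efuel k V) ≡⟨ cong₂ app (IH U (≤-trans (m≤m+n _ _) le)) (IH V (≤-trans (m≤n+m _ _) le)) ⟩
    app (E′ U) (E′ V)           ≡⟨ sym (·-≢H (E′ V) (λ e → h≢H (trans head-eq (E′≡H⇒head≡H U e)))) ⟩
    E′ U · E′ V                 ∎
    where
    open ≡-Reasoning
    head-eq : _ ≡ head U
    head-eq = cong proj₁ (trans (sym eq) (spine-app U V))

Efuel≡E′ : ∀ {n} k (t : Term n) → size t ≤ k → Efuel k t ≡ E′ t
Efuel≡E′ zero    (var _)   ()
Efuel≡E′ zero    H         ()
Efuel≡E′ zero    (lam _)   ()
Efuel≡E′ zero    (app _ _) ()
Efuel≡E′ (suc k) (var i)   _ = refl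
Efuel≡E′ (suc k) H         _ = refl
Efuel≡E′ (suc k) (lam t)   (s≤s le) = cong lam (Efuel≡E′ k t le)
Efuel≡E′ (suc k) (app U V) (s≤s le) with spine (app U V) in eq
... | H , (A ∷ As) = Efuel-app-H-spine k (Efuel≡E′ k) U V le eq
... | H , []       = ⊥-elim (nonempty (++-conicalʳ (args U) [ V ] (cong proj₂ (trans (sym (spine-app U V)) eq))))
  where
  nonempty : [ V ] ≢ []
  nonempty ()
... | var _ , _    = Efuel-app-≢H k (Efuel≡E′ k) U V le eq λ ()
... | lam _ , _    = Efuel-app-≢H k (Efuel≡E′ k) U V le eq λ ()
... | app _ _ , _  = Efuel-app-≢H k (Efuel≡E′ k) U V le eq λ ()

E≡E′ : ∀ {n} (t : Term n) → E t ≡ E′ t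
E≡E′ t = Efuel≡E′ (size t) t ≤-refl

rename-· : ∀ {m n} (ρ : Fin m → Fin n) a b → rename ρ (a · b) ≡ rename ρ a · rename ρ b
rename-· ρ (var _)   b = refl
rename-· ρ H         b = refl
rename-· ρ (lam _)   b = refl
rename-· ρ (app _ _) b = refl

E′-rename : ∀ {m n} (ρ : Fin m → Fin n) t → E′ (rename ρ t) ≡ rename ρ (E′ t)
E′-rename ρ (var i)   = refl
E′-rename ρ H         = refl
E′-rename ρ (lam t)   = cong lam (E′-rename (ext ρ) t)
E′-rename ρ (app a b) = trans (cong₂ _·_ (E′-rename ρ a) (E′-rename ρ b)) (sym (rename-· ρ (E′ a) (E′ b)))

subst· : ∀ {m n} → (Fin m → Term n) → Term m → Term n
subst· σ (var i)   = σ i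
subst· σ H         = H
subst· σ (lam t)   = lam (subst· (exts σ) t)
subst· σ (app a b) = subst· σ a · subst· σ b

subst·-· : ∀ {m n} (σ : Fin m → Term n) a b → subst· σ (a · b) ≡ subst· σ a · subst· σ b
subst·-· σ (var _)   b = refl
subst·-· σ H         b = refl
subst·-· σ (lam _)   b = refl
subst·-· σ (app _ _) b = refl

exts-cong : ∀ {m n} {σ τ : Fin m → Term n} → (∀ i → σ i ≡ τ i) → ∀ i → exts σ i ≡ exts τ i
exts-cong e zero    = refl
exts-cong e (suc i) = cong (rename suc) (e i)

subst·-cong : ∀ {m n} {σ τ : Fin m → Term n} → (∀ i → σ i ≡ τ i) → ∀ t → subst· σ t ≡ subst· τ t
subst·-cong e (var i)   = e i
subst·-cong e H         = refl
subst·-cong e (lam t)   = cong lam (subst·-cong (exts-cong e) t)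
subst·-cong e (app a b) = cong₂ _·_ (subst·-cong e a) (subst·-cong e b)

E′-exts : ∀ {m n} (σ : Fin m → Term n) i → E′ (exts σ i) ≡ exts (λ j → E′ (σ j)) i
E′-exts σ zero    = refl
E′-exts σ (suc i) = E′-rename suc (σ i)

E′-subst : ∀ {m n} (σ : Fin m → Term n) t → E′ (subst σ t) ≡ subst· (λ i → E′ (σ i)) (E′ t)
E′-subst σ (var i)   = refl
E′-subst σ H         = refl
E′-subst σ (lam t)   = cong lam (trans (E′-subst (exts σ) t) (subst·-cong (E′-exts σ) (E′ t)))
E′-subst σ (app a b) = trans (cong₂ _·_ (E′-subst σ a) (E′-subst σ b)) (sym (subst·-· _ (E′ a) (E′ b)))

E′-sub1 : ∀ {n} (x : Fin n) V y → E′ (sub1 x V y) ≡ sub1 x (E′ V) y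
E′-sub1 x V y with x ≟ y
... | yes _ = refl
... | no  _ = refl

E-[/] : ∀ {n} (U V : Term n) x → E (U [ V / x ]) ≡ subst· (sub1 x (E V)) (E U)
E-[/] U V x = begin
  E (U [ V / x ])                      ≡⟨ E≡E′ (U [ V / x ]) ⟩
  E′ (subst (sub1 x V) U)              ≡⟨ E′-subst (sub1 x V) U ⟩
  subst· (λ y → E′ (sub1 x V y)) (E′ U) ≡⟨ subst·-cong (E′-sub1 x V) (E′ U) ⟩
  subst· (sub1 x (E′ V)) (E′ U)        ≡⟨ sym (cong₂ (λ a b → subst· (sub1 x a) b) (E≡E′ V) (E≡E′ U)) ⟩
  subst· (sub1 x (E V)) (E U)          ∎
  where open ≡-Reasoning

lemma3p5 : ∀ {n : ℕ} (U₁ U₂ V₁ V₂ : Term n) (x : Fin n)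
    → E U₁ ≡ E U₂ → E V₁ ≡ E V₂
    → E (U₁ [ V₁ / x ]) ≡ E (U₂ [ V₂ / x ])
lemma3p5 U₁ U₂ V₁ V₂ x eU eV = begin
  E (U₁ [ V₁ / x ])              ≡⟨ E-[/] U₁ V₁ x ⟩
  subst· (sub1 x (E V₁)) (E U₁)  ≡⟨ cong₂ (λ a b → subst· (sub1 x a) b) eV eU ⟩
  subst· (sub1 x (E V₂)) (E U₂)  ≡⟨ sym (E-[/] U₂ V₂ x) ⟩
  E (U₂ [ V₂ / x ])              ∎
  where open ≡-Reasoning
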